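{- The axiom system $\mathsf{EKK}$ is sound for $\mathcal{L}_{E,K,\Box}$ with respect to the class of evidence interaction models: every theorem of $\mathsf{EKK}$ is true at every evidence scenario of every evidence interaction model.
   Context: $\mathcal{L}_{E,K,\Box}$ is generated by $\phi ::= p \mid \neg\phi \mid \phi\wedge\psi \mid E\phi \mid K\phi \mid \Box\phi$. An evidence interaction model is $\mathcal{M}=(X,\mathcal{E},\oplus,I,v)$ where $(\mathcal{E},\oplus)$ is a meet-semilattice, $X$ is a nonempty set, $I_e:X\to 2^X$ for $e\in\mathcal{E}$, $v:\textsc{prop}\to 2^X$, condition (E1) holds ($y\in I_e(x)$ implies $y\in I_e(y)$), and for all $x\in X$ and finite nonempty $\mathcal{E}'\subseteq\mathcal{E}$, $I_{\oplus\mathcal{E}'}(x)=\bigcap_{e\in\mathcal{E}'}I_e(x)$. Let $U_e=\{x : x\in I_e(x)\}$; an evidence scenario is $(x,e)$ with $x\in U_e$. Truth: $p$ via $v$; Booleans as usual; $(x,e)\models E\phi$ iff $I_e(x)\subseteq[\![\phi]\!]^e$; $(x,e)\models K\phi$ iff $U_e\subseteq[\![\phi]\!]^e$; $(x,e)\models\Box\phi$ iff there is $e'\in\mathcal{E}$ with $x\in U_{e\oplus e'}\subseteq[\![\phi]\!]^e$, where $[\![\phi]\!]^e=\{y\in U_e : (y,e)\models\phi\}$. $\mathsf{EKK}$ consists of: classical propositional logic with modus ponens; $\mathsf{S5}$ for $K$ (axioms K, T, 4, 5, necessitation); $\mathsf{KT}$ for $E$ (axioms K, T, necessitation); $K\phi\to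 E\phi$; $\mathsf{S4}$ for $\Box$ ($\Box(\phi\to\psi)\to(\Box\phi\to\Box\psi)$, $\Box\phi\to\phi$, $\Box\phi\to\Box\Box\phi$, necessitation for $\Box$); and $K\phi\to\Box\phi$. -}

module Defs where

open import Data.Nat using (ℕ)
open import Data.Bool using (Bool; true; false; not; _∧_)
open import Data.Product using (Σ; _×_; _,_)
open import Data.List.NonEmpty using (List⁺; foldr₁; toList)
open import Data.List.Relation.Unary.All using (All)
open import Relation.Nullary using (¬_)
open import Relation.Binary.PropositionalEquality using (_≡_)
open import Algebra.Lattice.Structures using (IsSemilattice)
open import Function.Bundles using (_⇔_)

data Fm : Set where
  var  : ℕ → Fm
  ¬'_  : Fm → Fm
  _∧'_ : Fm → Fm → Fm
  E'   : Fm → Fm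
  K'   : Fm → Fm
  □'   : Fm → Fm

infix  7 ¬'_
infixr 6 _∧'_
infixr 5 _⇒_

_⇒_ : Fm → Fm → Fm
φ ⇒ ψ = ¬' (φ ∧' ¬' ψ)

-- Classical propositional logic: all instances of propositional
-- tautologies (formulas whose Boolean value is true under every
-- assignment of truth values to their maximal non-Boolean subformulas,
-- i.e. propositional letters and modal formulas).

evalB : (Fm → Bool) → Fm → Bool
evalB ρ (var p)  = ρ (var p)
evalB ρ (¬' φ)   = not (evalB ρ φ)
evalB ρ (φ ∧' ψ) = evalB ρ φ ∧ evalB ρ ψ
evalB ρ (E' φ)   = ρ (E' φ)
evalB ρ (K' φ)   = ρ (K' φ)
evalB ρ (□' φ)   = ρ (□' φ)

Tautology : Fm → Set
Tautology φ = (ρ : Fm → Bool) → evalB ρ φ ≡ true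

data EKK : Fm → Set where
  taut  : ∀ {φ} → Tautology φ → EKK φ
  mp    : ∀ {φ ψ} → EKK (φ ⇒ ψ) → EKK φ → EKK ψ
  K-K   : ∀ {φ ψ} → EKK (K' (φ ⇒ ψ) ⇒ (K' φ ⇒ K' ψ))
  K-T   : ∀ {φ} → EKK (K' φ ⇒ φ)
  K-4   : ∀ {φ} → EKK (K' φ ⇒ K' (K' φ))
  K-5   : ∀ {φ} → EKK (¬' K' φ ⇒ K' (¬' K' φ))
  K-nec : ∀ {φ} → EKK φ → EKK (K' φ)
  E-K   : ∀ {φ ψ} → EKK (E' (φ ⇒ ψ) ⇒ (E' φ ⇒ E' ψ))
  E-T   : ∀ {φ} → EKK (E' φ ⇒ φ)
  E-nec : ∀ {φ} → EKK φ → EKK (E' φ)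
  KE    : ∀ {φ} → EKK (K' φ ⇒ E' φ)
  □-K   : ∀ {φ ψ} → EKK (□' (φ ⇒ ψ) ⇒ (□' φ ⇒ □' ψ))
  □-T   : ∀ {φ} → EKK (□' φ ⇒ φ)
  □-4   : ∀ {φ} → EKK (□' φ ⇒ □' (□' φ))
  □-nec : ∀ {φ} → EKK φ → EKK (□' φ)
  K□    : ∀ {φ} → EKK (K' φ ⇒ □' φ)

-- Evidence interaction models.  Subsets of X are predicates X → Set;
-- "y ∈ I e x" is written  I e x y.

record EIModel : Set₁ where
  field
    X      : Set
    inhabX : X
    Ev     : Set
    _⊕_    : Ev → Ev → Ev
    isSemilattice : IsSemilattice _≡_ _⊕_
    I      : Ev → X → X → Set
    v      : ℕ → X → Set
    E1     : ∀ e x y → I e x y → I e y y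
    -- for finite nonempty E' ⊆ Ev (given as a nonempty list of its
    -- elements): I_{⊕E'}(x) = ⋂_{e ∈ E'} I_e(x)
    I-meet : ∀ (es : List⁺ Ev) x y →
             I (foldr₁ _⊕_ es) x y ⇔ All (λ e → I e x y) (toList es)

  U : Ev → X → Set
  U e x = I e x x

open EIModel

_,_⊨_ : (M : EIModel) → X M × Ev M → Fm → Set
M , (x , e) ⊨ var p    = v M p x
M , (x , e) ⊨ (¬' φ)   = ¬ (M , (x , e) ⊨ φ)
M , (x , e) ⊨ (φ ∧' ψ) = (M , (x , e) ⊨ φ) × (M , (x , e) ⊨ ψ)
M , (x , e) ⊨ E' φ     = ∀ y → I M e x y → U M e y × (M , (y , e) ⊨ φ)
M , (x , e) ⊨ K' φ     = ∀ y → U M e y → U M e y × (M , (y , e) ⊨ φ)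
M , (x , e) ⊨ □' φ     =
  Σ (Ev M) λ e' → U M (_⊕_ M e e') x ×
    (∀ y → U M (_⊕_ M e e') y → U M e y × (M , (y , e) ⊨ φ))

module Submission where

-- The proof is the usual induction on derivations, carried out at a
-- fixed model M under the assumption of excluded middle (needed because
-- truth of ¬ and → is read constructively in Agda's Set).
--
--  * Propositional part: at every scenario, the Boolean valuation
--    "ρ ψ = is ψ true here" reflects the truth of every formula, so
--    each tautology is true; modus ponens is classical implication
--    elimination.
--  * Evidence combination: the meet condition on I, specialised to
--    two-element lists, says I_{a⊕b} = I_a ∩ I_b.  From it we get that
--    refining e by e₁⊕e₂ is the same as refining by e₁ and by e₂, and
--    that refining e by e itself changes nothing.
--  * Modal part: K is an S5 box over U_e; E is a reflexive box by (E1);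
--    K φ implies E φ (by (E1)) and □ φ (witness e' = e); the □-K axiom
--    uses the combined witness e₁ ⊕ e₂.  The necessitation rules for
--    E and □ then follow from the one for K.

open import Defs
open import Level using (0ℓ)
open import Data.Bool using (Bool)
open import Data.Product using (_,_; _×_; proj₁; proj₂)
open import Data.List using ([]; _∷_)
open import Data.List.NonEmpty using (_∷_)
open import Data.List.Relation.Unary.All using ([]; _∷_)
open import Relation.Nullary using (¬_)
open import Relation.Nullary.Decidable using (does; proof)
open import Relation.Nullary.Reflects using (Reflects; invert; ¬-reflects; _×-reflects_)
open import Relation.Binary.PropositionalEquality using (subst)
open import Function.Bundles using (_⇔_; mk⇔; Equivalence)
open import Axiom.ExcludedMiddle using (ExcludedMiddle)
open import Axiom.DoubleNegationElimination using (em⇒dne)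

module Soundness (lem : ExcludedMiddle 0ℓ) (M : EIModel) where

  open EIModel M

  Sat : X → Ev → Fm → Set
  Sat x e φ = M , (x , e) ⊨ φ

  Valid : Fm → Set
  Valid φ = ∀ x e → U e x → Sat x e φ

  ⇒-intro : {A B : Set} → (A → B) → ¬ (A × ¬ B)
  ⇒-intro f (a , ¬b) = ¬b (f a)

  ⇒-elim : {A B : Set} → ¬ (A × ¬ B) → A → B
  ⇒-elim ¬[a×¬b] a = em⇒dne lem (λ ¬b → ¬[a×¬b] (a , ¬b))

  truthAt : X → Ev → Fm → Bool
  truthAt x e ψ = does (lem {Sat x e ψ})

  evalB-reflects : ∀ x e φ → Reflects (Sat x e φ) (evalB (truthAt x e) φ)
  evalB-reflects x e (var p)  = proof lem
  evalB-reflects x e (¬' φ)   = ¬-reflects (evalB-reflects x e φ)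
  evalB-reflects x e (φ ∧' ψ) = evalB-reflects x e φ ×-reflects evalB-reflects x e ψ
  evalB-reflects x e (E' φ)   = proof lem
  evalB-reflects x e (K' φ)   = proof lem
  evalB-reflects x e (□' φ)   = proof lem

  tautology-true : ∀ {φ} → Tautology φ → ∀ x e → Sat x e φ
  tautology-true {φ} t x e =
    invert (subst (Reflects (Sat x e φ)) (t (truthAt x e)) (evalB-reflects x e φ))

  I-⊕ : ∀ a b x y → I (a ⊕ b) x y ⇔ (I a x y × I b x y)
  I-⊕ a b x y = mk⇔ split join
    where
      meet = I-meet (a ∷ b ∷ []) x y
      split : I (a ⊕ b) x y → I a x y × I b x y
      split h with Equivalence.to meet h
      ... | p ∷ q ∷ [] = p , q
      join : I a x y × I b x y → I (a ⊕ b) x y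
      join (p , q) = Equivalence.from meet (p ∷ q ∷ [])

  U-refine : ∀ e e₁ e₂ y → U (e ⊕ (e₁ ⊕ e₂)) y ⇔ (U (e ⊕ e₁) y × U (e ⊕ e₂) y)
  U-refine e e₁ e₂ y = mk⇔ split join
    where
      open Equivalence
      split : U (e ⊕ (e₁ ⊕ e₂)) y → U (e ⊕ e₁) y × U (e ⊕ e₂) y
      split h =
        let (ue , u₁₂) = to (I-⊕ e (e₁ ⊕ e₂) y y) h
            (u₁ , u₂)  = to (I-⊕ e₁ e₂ y y) u₁₂
        in from (I-⊕ e e₁ y y) (ue , u₁) , from (I-⊕ e e₂ y y) (ue , u₂)
      join : U (e ⊕ e₁) y × U (e ⊕ e₂) y → U (e ⊕ (e₁ ⊕ e₂)) y
      join (h₁ , h₂) =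
        let (ue , u₁) = to (I-⊕ e e₁ y y) h₁
            (_  , u₂) = to (I-⊕ e e₂ y y) h₂
        in from (I-⊕ e (e₁ ⊕ e₂) y y) (ue , from (I-⊕ e₁ e₂ y y) (u₁ , u₂))

  U-⊕-self : ∀ e y → U (e ⊕ e) y ⇔ U e y
  U-⊕-self e y = mk⇔ (λ h → proj₁ (to h)) (λ u → from (u , u))
    where open Equivalence (I-⊕ e e y y)

  -- K φ implies E φ: every I_e-successor lies in U_e by (E1).
  K⇒E : ∀ {x e φ} → Sat x e (K' φ) → Sat x e (E' φ)
  K⇒E {x} {e} k y i = k y (E1 e x y i)

  K⇒□ : ∀ {x e φ} → U e x → Sat x e (K' φ) → Sat x e (□' φ)
  K⇒□ {x} {e} u k =
    e , Equivalence.from (U-⊕-self e x) u , λ y u' → k y (Equivalence.to (U-⊕-self e y) u')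

  K-necessitation : ∀ {φ} → Valid φ → Valid (K' φ)
  K-necessitation ⊨φ x e u y uy = uy , ⊨φ y e uy

  □-distribution : ∀ {x e φ ψ} →
                   Sat x e (□' (φ ⇒ ψ)) → Sat x e (□' φ) → Sat x e (□' ψ)
  □-distribution {x} {e} {φ} {ψ} (e₁ , u₁ , h₁) (e₂ , u₂ , h₂) =
    e₁ ⊕ e₂ , Equivalence.from (U-refine e e₁ e₂ x) (u₁ , u₂) , conclude
    where
      conclude : ∀ y → U (e ⊕ (e₁ ⊕ e₂)) y → U e y × Sat y e ψ
      conclude y u with Equivalence.to (U-refine e e₁ e₂ y) u
      ... | v₁ , v₂ = proj₁ (h₁ y v₁) , ⇒-elim (proj₂ (h₁ y v₁)) (proj₂ (h₂ y v₂))

  sound : ∀ {φ} → EKK φ → Valid φ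
  sound (taut {φ} t)    x e u = tautology-true {φ} t x e
  sound (mp d d′)       x e u = ⇒-elim (sound d x e u) (sound d′ x e u)
  sound K-K             x e u = ⇒-intro λ h → ⇒-intro λ k y uy →
    uy , ⇒-elim (proj₂ (h y uy)) (proj₂ (k y uy))
  sound K-T             x e u = ⇒-intro λ k → proj₂ (k x u)
  sound K-4             x e u = ⇒-intro λ k y uy → uy , k
  sound K-5             x e u = ⇒-intro λ ¬k y uy → uy , ¬k
  sound (K-nec {φ} d)         = K-necessitation {φ} (sound d)
  sound E-K             x e u = ⇒-intro λ h → ⇒-intro λ k y i →
    proj₁ (h y i) , ⇒-elim (proj₂ (h y i)) (proj₂ (k y i))
  sound E-T             x e u = ⇒-intro λ k → proj₂ (k x u)
  sound (E-nec {φ} d)   x e u = K⇒E {φ = φ} (K-necessitation {φ} (sound d) x e u)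
  sound (KE {φ})        x e u = ⇒-intro (K⇒E {φ = φ})
  sound (□-K {φ} {ψ})   x e u = ⇒-intro λ h → ⇒-intro (□-distribution {φ = φ} {ψ} h)
  sound □-T             x e u = ⇒-intro λ { (e′ , ux , h) → proj₂ (h x ux) }
  sound □-4             x e u = ⇒-intro λ { (e′ , ux , h) →
    e′ , ux , λ y uy → proj₁ (h y uy) , (e′ , uy , h) }
  sound (□-nec {φ} d)   x e u = K⇒□ {φ = φ} u (K-necessitation {φ} (sound d) x e u)
  sound (K□ {φ})        x e u = ⇒-intro (K⇒□ {φ = φ} u)

theorem6 : ExcludedMiddle 0ℓ →
           ∀ {φ} → EKK φ →
           (M : EIModel) → (x : EIModel.X M) → (e : EIModel.Ev M) →
           EIModel.U M e x → M , (x , e) ⊨ φ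
theorem6 lem d M = Soundness.sound lem M d
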